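{- With $\mathsf{MoToNe}$ and $\mathsf{NeToMo}$ defined below, $\mathsf{MoToNe}\circ\mathsf{NeToMo}$ is the identity on neutral $\lambda$-terms and $\mathsf{NeToMo}\circ\mathsf{MoToNe}$ is the identity on Motzkin trees.
   Context: $\lambda$-terms in de Bruijn notation are generated by $T ::= \underline{\mathsf{n}} \mid \lambda T \mid T\,T$, where indices are generated by $\underline{\mathsf{0}}$ and $S\,\underline{\mathsf{n}}$. Normal forms $\mathcal N$ and neutral terms $\mathcal M$ are defined by $\mathcal N = \mathcal M \mid \lambda\,\mathcal N$ and $\mathcal M = \mathcal M\,\mathcal N \mid \underline{\mathsf{n}}$. Motzkin trees are plane rooted trees in which each node has $0$, $1$ (unary) or $2$ (binary, ordered) children. For $n\ge1$, a unary path $u_n$ is a chain of $n$ nodes each with one child except the last, which is a leaf. $\mathsf{MoToNe}$: (1) $u_n\mapsto S^{n-1}\underline{\mathsf{0}}$; (2) a chain of $n\ge1$ unary nodes on top of a binary node with left subtree $t$ and right subtree $t'$ $\mapsto \mathsf{MoToNe}(t)\,(\lambda^n\,\mathsf{MoToNe}(t'))$; (3) binary root with subtrees $t,t'$ $\mapsto \mathsf{MoToNe}(t)\,\mathsf{MoToNe}(t')$. $\mathsf{NeToMo}$: (1) the index $S^{n-1}\underline{\mathsf{0}}$ ($n\ge1$) $\mapsto u_n$; (2) $t\,(\lambda^n t')$ with $n\ge1$ and $t'$ not starting with $\lambda$ $\mapsto$ a chain of $n$ unary nodes on top of a binary node with left subtree $\mathsf{NeToMo}(t)$ and right subtree $\mathsf{NeToMo}(t')$;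 (3) $t\,t'$ with $t'$ not starting with $\lambda$ $\mapsto$ binary root with left subtree $\mathsf{NeToMo}(t)$ and right subtree $\mathsf{NeToMo}(t')$. -}

module Defs where

open import Data.Nat using (ℕ; zero; suc)

-- Untyped λ-terms in de Bruijn notation.  A de Bruijn index S^n 0 is
-- represented by the natural number n.
data Term : Set where
  var : ℕ → Term
  lam : Term → Term
  app : Term → Term → Term

mutual
  data Normal : Term → Set where
    neu : ∀ {t} → Neutral t → Normal t
    lam : ∀ {t} → Normal t → Normal (lam t)

  data Neutral : Term → Set where
    var : ∀ n → Neutral (var n)
    app : ∀ {t u} → Neutral t → Normal u → Neutral (app t u)

data Motzkin : Set where
  leaf  : Motzkin
  unary : Motzkin → Motzkin
  binary : Motzkin → Motzkin → Motzkin

lams : ℕ → Term → Term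
lams zero t = t
lams (suc n) t = lam (lams n t)

unaries : ℕ → Motzkin → Motzkin
unaries zero t = t
unaries (suc n) t = unary (unaries n t)

-- MoToNe.  `moChain k t` handles a tree consisting of k unary nodes on top of t.
mutual
  moToNe : Motzkin → Term
  moToNe t = moChain 0 t

  moChain : ℕ → Motzkin → Term
  -- (1) u_n with n = k+1 nodes (k unary nodes above a leaf) ↦ S^{n-1} 0
  moChain k leaf = var k
  moChain k (unary t) = moChain (suc k) t
  -- (3) binary root
  moChain zero (binary t t') = app (moToNe t) (moToNe t')
  -- (2) n ≥ 1 unary nodes on top of a binary node
  moChain (suc n) (binary t t') = app (moToNe t) (lams (suc n) (moToNe t'))

-- NeToMo (meant for neutral terms; its value on other terms is irrelevant).
-- `neApp l k u` handles the term  t (λ^k u)  where l = NeToMo t.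
mutual
  neToMo : Term → Motzkin
  -- (1) S^{n-1} 0 ↦ u_n, i.e. index n ↦ n unary nodes above a leaf (n+1 nodes)
  neToMo (var n) = unaries n leaf
  neToMo (lam t) = leaf   -- not a neutral term; arbitrary
  neToMo (app t u) = neApp (neToMo t) 0 u

  neApp : Motzkin → ℕ → Term → Motzkin
  neApp l k (lam u) = neApp l (suc k) u
  -- (2)/(3): k unary nodes (k = 0 is rule (3)) on top of a binary node
  neApp l k (var n) = unaries k (binary l (neToMo (var n)))
  neApp l k (app u v) = unaries k (binary l (neToMo (app u v)))

-- Both translations walk along a *chain*: MoToNe counts the unary nodes
-- above a node (moChain k), NeToMo counts the λs in front of the argument
-- of an application (neApp l k).  The proof therefore first establishes how
-- each translation behaves on a whole chain at once:
--   * moChain k (unaries n m) = moChain (n + k) m, and on a binary node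
--     moChain k produces  t (λ^k t');
--   * neApp l k (λ^j u) = neApp l (j + k) u, and on a term that does not
--     start with λ, neApp l k produces k unary nodes over a binary node.
-- Neutral terms and every output of MoToNe do not start with λ, which is
-- what makes the two chain descriptions match.  The first identity then
-- follows by mutual induction on the Neutral/Normal derivation (normal
-- arguments carry their leading λs into the counter k), the second by
-- induction on the tree with the unary counter k generalised.

module Submission where

open import Defs
open import Data.Nat using (ℕ; zero; suc; _+_)
open import Data.Nat.Properties using (+-identityʳ; +-suc)
open import Data.Product using (_×_; _,_)
open import Relation.Binary.PropositionalEquality
  using (_≡_; refl; cong; cong₂; sym; module ≡-Reasoning)
open ≡-Reasoning

-- Terms whose root is not a λ-abstraction: the "t' not starting with λ"
-- side condition of rules (2) and (3).
data NotLam : Term → Set where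
  var : ∀ n → NotLam (var n)
  app : ∀ t u → NotLam (app t u)

neutral⇒notLam : ∀ {t} → Neutral t → NotLam t
neutral⇒notLam (var n)            = var n
neutral⇒notLam (app {t} {u} _ _) = app t u

unaries-suc : ∀ k m → unaries k (unary m) ≡ unaries (suc k) m
unaries-suc zero    m = refl
unaries-suc (suc k) m = cong unary (unaries-suc k m)

lams-suc : ∀ k u → lams k (lam u) ≡ lams (suc k) u
lams-suc zero    u = refl
lams-suc (suc k) u = cong lam (lams-suc k u)

moChain-unaries : ∀ n k m → moChain k (unaries n m) ≡ moChain (n + k) m
moChain-unaries zero    k m = refl
moChain-unaries (suc n) k m = begin
  moChain (suc k) (unaries n m) ≡⟨ moChain-unaries n (suc k) m ⟩
  moChain (n + suc k) m         ≡⟨ cong (λ j → moChain j m) (+-suc n k) ⟩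
  moChain (suc n + k) m         ∎

moToNe-unaries : ∀ n m → moToNe (unaries n m) ≡ moChain n m
moToNe-unaries n m = begin
  moChain 0 (unaries n m) ≡⟨ moChain-unaries n 0 m ⟩
  moChain (n + 0) m       ≡⟨ cong (λ j → moChain j m) (+-identityʳ n) ⟩
  moChain n m             ∎

moChain-binary : ∀ k l r → moChain k (binary l r) ≡ app (moToNe l) (lams k (moToNe r))
moChain-binary zero    l r = refl
moChain-binary (suc k) l r = refl

moChain-notLam : ∀ k m → NotLam (moChain k m)
moChain-notLam k       leaf         = var k
moChain-notLam k       (unary m)    = moChain-notLam (suc k) m
moChain-notLam zero    (binary l r) = app _ _
moChain-notLam (suc k) (binary l r) = app _ _

neApp-lams : ∀ l k j u → neApp l k (lams j u) ≡ neApp l (j + k) u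
neApp-lams l k zero    u = refl
neApp-lams l k (suc j) u = begin
  neApp l (suc k) (lams j u) ≡⟨ neApp-lams l (suc k) j u ⟩
  neApp l (j + suc k) u      ≡⟨ cong (λ i → neApp l i u) (+-suc j k) ⟩
  neApp l (suc j + k) u      ∎

neApp-notLam : ∀ l k {u} → NotLam u → neApp l k u ≡ unaries k (binary l (neToMo u))
neApp-notLam l k (var n)   = refl
neApp-notLam l k (app t u) = refl

-- First identity.  The Normal case is generalised over the already
-- translated function part l and the number k of λs consumed so far.
mutual
  moToNe∘neToMo-neutral : ∀ {t} → Neutral t → moToNe (neToMo t) ≡ t
  moToNe∘neToMo-neutral (var n) = moToNe-unaries n leaf
  moToNe∘neToMo-neutral (app {t} {u} nt nu) = begin
    moToNe (neApp (neToMo t) 0 u) ≡⟨ moToNe-neApp nu (neToMo t) 0 ⟩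
    app (moToNe (neToMo t)) u     ≡⟨ cong (λ f → app f u) (moToNe∘neToMo-neutral nt) ⟩
    app t u                       ∎

  moToNe-neApp : ∀ {u} → Normal u → ∀ l k →
                 moToNe (neApp l k u) ≡ app (moToNe l) (lams k u)
  moToNe-neApp (lam {u} nu) l k = begin
    moToNe (neApp l (suc k) u)      ≡⟨ moToNe-neApp nu l (suc k) ⟩
    app (moToNe l) (lams (suc k) u) ≡⟨ cong (app (moToNe l)) (sym (lams-suc k u)) ⟩
    app (moToNe l) (lams k (lam u)) ∎
  moToNe-neApp (neu {u} nu) l k = begin
    moToNe (neApp l k u)                          ≡⟨ cong moToNe (neApp-notLam l k (neutral⇒notLam nu)) ⟩
    moToNe (unaries k (binary l (neToMo u)))      ≡⟨ moToNe-unaries k _ ⟩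
    moChain k (binary l (neToMo u))               ≡⟨ moChain-binary k l (neToMo u) ⟩
    app (moToNe l) (lams k (moToNe (neToMo u)))   ≡⟨ cong (λ v → app (moToNe l) (lams k v)) (moToNe∘neToMo-neutral nu) ⟩
    app (moToNe l) (lams k u)                     ∎

neToMo∘moChain : ∀ k m → neToMo (moChain k m) ≡ unaries k m
neToMo∘moChain k leaf = refl
neToMo∘moChain k (unary m) = begin
  neToMo (moChain (suc k) m) ≡⟨ neToMo∘moChain (suc k) m ⟩
  unaries (suc k) m          ≡⟨ sym (unaries-suc k m) ⟩
  unaries k (unary m)        ∎
neToMo∘moChain k (binary l r) = begin
  neToMo (moChain k (binary l r))
    ≡⟨ cong neToMo (moChain-binary k l r) ⟩
  neApp l' 0 (lams k (moToNe r))
    ≡⟨ neApp-lams l' 0 k (moToNe r) ⟩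
  neApp l' (k + 0) (moToNe r)
    ≡⟨ cong (λ i → neApp l' i (moToNe r)) (+-identityʳ k) ⟩
  neApp l' k (moToNe r)
    ≡⟨ neApp-notLam l' k (moChain-notLam 0 r) ⟩
  unaries k (binary l' (neToMo (moToNe r)))
    ≡⟨ cong (unaries k) (cong₂ binary (neToMo∘moChain 0 l) (neToMo∘moChain 0 r)) ⟩
  unaries k (binary l r) ∎
  where
  l' : Motzkin
  l' = neToMo (moToNe l)

mainTheorem8 : (∀ (t : Term) → Neutral t → moToNe (neToMo t) ≡ t)
               × (∀ (m : Motzkin) → neToMo (moToNe m) ≡ m)
mainTheorem8 = (λ t nt → moToNe∘neToMo-neutral nt)
             , (λ m → neToMo∘moChain 0 m)
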